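{- Let $G$ be a graph on ten vertices such that both $G$ and $\overline{G}$ are minimally t-imperfect. Suppose $G$ contains a $5$-hole $v_1v_2v_3v_4v_5$ and the other five vertices are $u_1,\dots,u_5$, where for each $i$ the neighbours of $u_i$ on the hole are $v_{i+2}$, $v_{i+3}$ and possibly $v_i$ (indices modulo $5$). If $u_iu_{i+1}\in E(G)$ for all $i=1,\dots,5$, then $G$ is $(3,3)$-partitionable.
   Context: All graphs are finite and simple; a $5$-hole is an induced $5$-cycle. For a graph $G$, let $P(G)$ be the polytope in $\mathbb{R}^{V(G)}$ defined by $0\le x_v\le 1$, $x_u+x_v\le1$ for every edge $uv$, and $\sum_{v\in V(C)}x_v\le(|V(C)|-1)/2$ for every induced odd cycle $C$; $G$ is t-perfect if $P(G)$ equals the convex hull of characteristic vectors of independent sets, t-imperfect otherwise. If $N(v)$ is independent, the t-contraction at $v$ contracts $N(v)\cup\{v\}$ to one vertex. A t-minor is obtained by vertex deletions and t-contractions; proper if it has fewer vertices. $G$ is minimally t-imperfect if it is t-imperfect and all proper t-minors are t-perfect. A graph is $(3,3)$-partitionable if it has $10$ vertices and for every vertex $v$, the remaining $9$ vertices can be partitioned into $3$ independent sets of size $3$ and also into $3$ cliques of size $3$. -}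

module Defs where

open import Data.Bool using (Bool; true; false; not; if_then_else_)
open import Data.Nat as ℕ using (ℕ; zero; suc; _%_)
open import Data.Nat.DivMod using (m%n<n)
open import Data.Fin using (Fin; toℕ; fromℕ<)
open import Data.Fin.Properties using (_≟_)
open import Data.Integer using (+_)
open import Data.Rational using (ℚ; 0ℚ; 1ℚ; _+_; _*_; _≤_; _/_)
open import Data.Product using (Σ; ∃; ∃-syntax; _×_; _,_)
open import Data.Sum using (_⊎_)
open import Function using (_∘_; _⇔_)
open import Relation.Nullary using (¬_; does)
open import Relation.Binary.PropositionalEquality using (_≡_; _≢_)
open import Relation.Binary.Construct.Closure.ReflexiveTransitive using (Star)

record Graph : Set where
  field
    n   : ℕ
    adj : Fin n → Fin n → Bool
    sym : ∀ a b → adj a b ≡ adj b a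
    irr : ∀ a → adj a a ≡ false
open Graph public

Adj : (G : Graph) → Fin (n G) → Fin (n G) → Set
Adj G a b = adj G a b ≡ true

complement : Graph → Graph
complement G = record { n = n G ; adj = cadj ; sym = csym ; irr = cirr }
  where
  cadj : Fin (n G) → Fin (n G) → Bool
  cadj a b = if does (a ≟ b) then false else not (adj G a b)
  csym : ∀ a b → cadj a b ≡ cadj b a
  csym a b with a ≟ b | b ≟ a
  ... | Relation.Nullary.yes _ | Relation.Nullary.yes _ = _≡_.refl
  ... | Relation.Nullary.yes p | Relation.Nullary.no q = Data.Empty.⊥-elim (q (Relation.Binary.PropositionalEquality.sym p))
    where import Data.Empty
  ... | Relation.Nullary.no p | Relation.Nullary.yes q = Data.Empty.⊥-elim (p (Relation.Binary.PropositionalEquality.sym q))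
    where import Data.Empty
  ... | Relation.Nullary.no _ | Relation.Nullary.no _ =
    Relation.Binary.PropositionalEquality.cong not (Graph.sym G a b)
  cirr : ∀ a → cadj a a ≡ false
  cirr a with a ≟ a
  ... | Relation.Nullary.yes _ = _≡_.refl
  ... | Relation.Nullary.no p = Data.Empty.⊥-elim (p _≡_.refl)
    where import Data.Empty

Injective : ∀ {k m} → (Fin k → Fin m) → Set
Injective f = ∀ i j → f i ≡ f j → i ≡ j

Consec : (ℓ : ℕ) → Fin (suc ℓ) → Fin (suc ℓ) → Set
Consec ℓ i j = toℕ j ≡ suc (toℕ i) % suc ℓ ⊎ toℕ i ≡ suc (toℕ j) % suc ℓ

InducedCycle : (G : Graph) {ℓ : ℕ} → (Fin (suc ℓ) → Fin (n G)) → Set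
InducedCycle G {ℓ} c = Injective c × (∀ i j → Adj G (c i) (c j) ⇔ Consec ℓ i j)

sumℚ : ∀ {k} → (Fin k → ℚ) → ℚ
sumℚ {zero}  f = 0ℚ
sumℚ {suc k} f = f Fin.zero + sumℚ (f ∘ Fin.suc)
  where import Data.Fin as Fin

ℕtoℚ : ℕ → ℚ
ℕtoℚ m = (+ m) / 1

-- P(G): box, edge and induced-odd-cycle inequalities.  An odd cycle has
-- length 2m+3 (m ≥ 0), with right-hand side (|C|-1)/2 = m+1.
InP : (G : Graph) → (Fin (n G) → ℚ) → Set
InP G x =
  (∀ v → 0ℚ ≤ x v × x v ≤ 1ℚ) ×
  (∀ a b → Adj G a b → x a + x b ≤ 1ℚ) ×
  (∀ (m : ℕ) (c : Fin (3 ℕ.+ 2 ℕ.* m) → Fin (n G)) →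
     InducedCycle G c → sumℚ (x ∘ c) ≤ ℕtoℚ (suc m))

Independent : (G : Graph) → (Fin (n G) → Bool) → Set
Independent G S = ∀ a b → S a ≡ true → S b ≡ true → adj G a b ≡ false

indicator : Bool → ℚ
indicator b = if b then 1ℚ else 0ℚ

InStab : (G : Graph) → (Fin (n G) → ℚ) → Set
InStab G x =
  ∃[ k ] Σ (Fin k → ℚ) λ λs → Σ (Fin k → Fin (n G) → Bool) λ S →
    (∀ j → Independent G (S j)) ×
    (∀ j → 0ℚ ≤ λs j) ×
    sumℚ λs ≡ 1ℚ ×
    (∀ v → x v ≡ sumℚ (λ j → λs j * indicator (S j v)))

TPerfect : Graph → Set
TPerfect G = ∀ x → InP G x ⇔ InStab G x

DeleteStep : Graph → Graph → Set
DeleteStep G H =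
  Σ (Fin (n G)) λ v → Σ (Fin (n H) → Fin (n G)) λ f →
    Injective f ×
    (∀ a → f a ≢ v) ×
    (∀ w → w ≢ v → ∃[ a ] f a ≡ w) ×
    (∀ a b → adj H a b ≡ adj G (f a) (f b))

InClosedNbhd : (G : Graph) → Fin (n G) → Fin (n G) → Set
InClosedNbhd G v x = x ≡ v ⊎ Adj G v x

-- H ≅ t-contraction of G at v (N(v) independent; N(v) ∪ {v} contracted
-- to one vertex, g is the quotient map)
ContractStep : Graph → Graph → Set
ContractStep G H =
  Σ (Fin (n G)) λ v →
    (∀ a b → Adj G v a → Adj G v b → adj G a b ≡ false) ×
    Σ (Fin (n G) → Fin (n H)) λ g →
      (∀ b → ∃[ x ] g x ≡ b) ×
      (∀ x y → (g x ≡ g y) ⇔ (x ≡ y ⊎ (InClosedNbhd G v x × InClosedNbhd G v y))) ×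
      (∀ a b → Adj H a b ⇔ (a ≢ b × ∃[ x ] ∃[ y ] (g x ≡ a × g y ≡ b × Adj G x y)))

Step : Graph → Graph → Set
Step G H = DeleteStep G H ⊎ ContractStep G H

TMinor : Graph → Graph → Set
TMinor G H = Star Step G H

MinimallyTImperfect : Graph → Set
MinimallyTImperfect G =
  ¬ TPerfect G × (∀ H → TMinor G H → n H ℕ.< n G → TPerfect H)

-- (3,3)-partitionability.  A partition of V ∖ {v} into 3 sets of size 3
-- is an injective σ : Fin 3 × Fin 3 → V with image exactly V ∖ {v};
-- the parts are σ k _ .

Partition33 : (G : Graph) → Fin (n G) → (Fin 3 → Fin 3 → Fin (n G)) → Set
Partition33 G v σ =
  (∀ k j k' j' → σ k j ≡ σ k' j' → k ≡ k' × j ≡ j') ×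
  (∀ k j → σ k j ≢ v) ×
  (∀ w → w ≢ v → ∃[ k ] ∃[ j ] σ k j ≡ w)

Partitionable33 : Graph → Set
Partitionable33 G =
  n G ≡ 10 ×
  (∀ v →
    (∃[ σ ] Partition33 G v σ × (∀ k j j' → adj G (σ k j) (σ k j') ≡ false)) ×
    (∃[ σ ] Partition33 G v σ × (∀ k j j' → j ≢ j' → Adj G (σ k j) (σ k j'))))

_⊕_ : Fin 5 → ℕ → Fin 5
i ⊕ k = fromℕ< (m%n<n (toℕ i ℕ.+ k) 5)

{-# OPTIONS --safe #-}
module Submission where

-- If a chord u_i u_{i+2} were present, deleting v_{i+3}, v_{i+4} and u_{i+1} would leave a graph
-- on seven vertices without a stable set of size three.  The constant vector 1/3 lies in P of
-- every graph, since (2m+3)/3 ≤ m+1, and here it has weight 7/3 while every convex combination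
-- of stable sets has weight at most 2: this proper t-minor would be t-imperfect.  Without those
-- chords all adjacencies of G are determined except those of the pairs u_i v_i, and explicit
-- partitions avoiding these pairs give (3,3)-partitionability.

open import Defs
open import Algebra.Bundles using (Ring)
open import Data.Bool using (Bool; true; false; T)
open import Data.Bool.Properties using (¬-not) renaming (_≟_ to _≟ᵇ_)
open import Data.Empty using (⊥; ⊥-elim)
open import Data.Fin as Fin using (Fin; toℕ; punchIn; punchOut)
open import Data.Fin.Patterns
open import Data.Fin.Properties using (_≟_; all?; any?; punchIn-injective; punchInᵢ≢i; punchIn-punchOut)
open import Data.Fin.Subset using (Subset)
open import Data.Fin.Subset.Properties using (anySubset?)
import Data.Integer as ℤ
open import Data.Integer.Tactic.RingSolver using (solve-∀)
open import Data.Nat as ℕ using (ℕ; zero; suc; _%_)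
import Data.Nat.Properties as ℕ
open import Data.Product using (∃; ∃-syntax; _×_; _,_; proj₁; proj₂; curry; uncurry)
open import Data.Product.Properties using (×-≡,≡←≡) renaming (≡-dec to ×-≡-dec)
open import Data.Rational using (ℚ; 0ℚ; 1ℚ; _+_; _*_; _≤_; _<_; _/_; toℚᵘ; nonNegative)
open import Data.Rational.Properties
  using (_≤?_; _<?_; ≤-refl; +-mono-≤; ≮⇒≥; <-irrefl; <-≤-trans; *-monoˡ-≤-nonNeg; *-identityˡ;
         +-*-ring; toℚᵘ-injective; toℚᵘ-fromℚᵘ; toℚᵘ-homo-+; module ≤-Reasoning)
import Data.Rational.Unnormalised as ℚᵘ
import Data.Rational.Unnormalised.Properties as ℚᵘ
open import Data.Sum using (_⊎_; inj₁; inj₂; [_,_]; [_,_]′) renaming (map to map⊎)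
open import Data.Sum.Properties using () renaming (≡-dec to ⊎-≡-dec)
open import Data.Vec using (Vec; []; _∷_; lookup; tabulate)
open import Data.Vec.Properties using (lookup∘tabulate)
open import Function using (_∘_; Equivalence)
open import Relation.Binary.Construct.Closure.ReflexiveTransitive using (ε; _◅_; _◅◅_)
open import Relation.Binary.Definitions using (DecidableEquality)
open import Relation.Binary.PropositionalEquality as ≡ using (_≡_; _≢_; _≗_; refl; trans; cong; subst)
open import Relation.Nullary using (¬_; Dec; no)
open import Relation.Nullary.Decidable using (from-yes; from-no; map′; ¬?; _×-dec_; _⊎-dec_; _→-dec_; T?)
open import Relation.Unary using (Decidable)

open import Algebra.Properties.Semiring.Sum (Ring.semiring +-*-ring)
  using (sum; sum-cong-≗; sum-replicate; ∑-comm; *-distribˡ-sum; *-distribʳ-sum)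
open import Algebra.Properties.Semiring.Mult (Ring.semiring +-*-ring)
  using (×-assocˡ) renaming (_×_ to _·_)

⅓ 2ℚ : ℚ
⅓ = ℤ.+ 1 / 3
2ℚ = ℤ.+ 2 / 1

sumℚ≡sum : ∀ {k} (f : Fin k → ℚ) → sumℚ f ≡ sum f
sumℚ≡sum {zero}  f = refl
sumℚ≡sum {suc k} f = cong (_+_ (f 0F)) (sumℚ≡sum (f ∘ Fin.suc))

sumℚ-cong : ∀ {k} {f g : Fin k → ℚ} → f ≗ g → sumℚ f ≡ sumℚ g
sumℚ-cong {f = f} {g} f≗g = trans (sumℚ≡sum f) (trans (sum-cong-≗ f≗g) (≡.sym (sumℚ≡sum g)))

sumℚ-const : ∀ k c → sumℚ {k} (λ _ → c) ≡ k · c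
sumℚ-const k c = trans (sumℚ≡sum {k} (λ _ → c)) (sum-replicate k {c})

sum-mono-≤ : ∀ {k} {f g : Fin k → ℚ} → (∀ i → f i ≤ g i) → sum f ≤ sum g
sum-mono-≤ {zero}  f≤g = ≤-refl
sum-mono-≤ {suc k} f≤g = +-mono-≤ (f≤g 0F) (sum-mono-≤ (f≤g ∘ Fin.suc))

-- ℕtoℚ normalises by a gcd, which does not compute on variables; hence the detour through ℚᵘ.
ℕtoℚ-suc : ∀ k → ℕtoℚ (suc k) ≡ 1ℚ + ℕtoℚ k
ℕtoℚ-suc k = toℚᵘ-injective (begin
  toℚᵘ (ℕtoℚ (suc k))        ≈⟨ toℚᵘ-fromℚᵘ (ι (suc k)) ⟩
  ι (suc k)                  ≈⟨ ℚᵘ.*≡* (cross-multiplied (ℤ.+ k)) ⟩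
  ℚᵘ.1ℚᵘ ℚᵘ.+ ι k            ≈⟨ ℚᵘ.+-congʳ ℚᵘ.1ℚᵘ (ℚᵘ.≃-sym (toℚᵘ-fromℚᵘ (ι k))) ⟩
  ℚᵘ.1ℚᵘ ℚᵘ.+ toℚᵘ (ℕtoℚ k)  ≈⟨ ℚᵘ.≃-sym (toℚᵘ-homo-+ 1ℚ (ℕtoℚ k)) ⟩
  toℚᵘ (1ℚ + ℕtoℚ k)         ∎)
  where
  open ℚᵘ.≃-Reasoning
  ι : ℕ → ℚᵘ.ℚᵘ
  ι m = ℚᵘ.mkℚᵘ (ℤ.+ m) 0
  cross-multiplied : ∀ i → (ℤ.+ 1 ℤ.+ i) ℤ.* (ℤ.+ 1 ℤ.* ℤ.+ 1) ≡
                           (ℤ.+ 1 ℤ.* ℤ.+ 1 ℤ.+ i ℤ.* ℤ.+ 1) ℤ.* ℤ.+ 1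
  cross-multiplied = solve-∀

·1ℚ≡ℕtoℚ : ∀ k → k · 1ℚ ≡ ℕtoℚ k
·1ℚ≡ℕtoℚ zero    = refl
·1ℚ≡ℕtoℚ (suc k) = trans (cong (1ℚ +_) (·1ℚ≡ℕtoℚ k)) (≡.sym (ℕtoℚ-suc k))

·-nonNeg : ∀ {x} → 0ℚ ≤ x → ∀ k → 0ℚ ≤ k · x
·-nonNeg 0≤x zero    = ≤-refl
·-nonNeg 0≤x (suc k) = +-mono-≤ 0≤x (·-nonNeg 0≤x k)

·-monoˡ-≤ : ∀ {x} → 0ℚ ≤ x → ∀ {k m} → k ℕ.≤ m → k · x ≤ m · x
·-monoˡ-≤ 0≤x {m = m} ℕ.z≤n = ·-nonNeg 0≤x m
·-monoˡ-≤ {x} 0≤x (ℕ.s≤s k≤m) = +-mono-≤ (≤-refl {x}) (·-monoˡ-≤ 0≤x k≤m)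

0≤⅓ : 0ℚ ≤ ⅓
0≤⅓ = from-yes (0ℚ ≤? ⅓)

⅓-InP : (H : Graph) → InP H (λ _ → ⅓)
⅓-InP H =
  (λ _ → 0≤⅓ , from-yes (⅓ ≤? 1ℚ)) , (λ _ _ _ → from-yes (⅓ + ⅓ ≤? 1ℚ)) , λ m _ _ → oddCycle m
  where
  open ≤-Reasoning
  oddCycle : ∀ m → sumℚ {3 ℕ.+ 2 ℕ.* m} (λ _ → ⅓) ≤ ℕtoℚ (suc m)
  oddCycle m = begin
    sumℚ {3 ℕ.+ 2 ℕ.* m} (λ _ → ⅓)  ≡⟨ sumℚ-const (3 ℕ.+ 2 ℕ.* m) ⅓ ⟩
    (3 ℕ.+ 2 ℕ.* m) · ⅓             ≤⟨ ·-monoˡ-≤ 0≤⅓ (ℕ.+-monoʳ-≤ 3 (ℕ.*-monoˡ-≤ m (ℕ.n≤1+n 2))) ⟩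
    (3 ℕ.+ 3 ℕ.* m) · ⅓             ≡⟨ cong (_· ⅓) 3+3m≡[1+m]3 ⟩
    (suc m ℕ.* 3) · ⅓               ≡⟨ ≡.sym (×-assocˡ ⅓ (suc m) 3) ⟩
    suc m · 1ℚ                      ≡⟨ ·1ℚ≡ℕtoℚ (suc m) ⟩
    ℕtoℚ (suc m)                    ∎
    where
    3+3m≡[1+m]3 : 3 ℕ.+ 3 ℕ.* m ≡ suc m ℕ.* 3
    3+3m≡[1+m]3 = trans (≡.sym (ℕ.*-suc 3 m)) (ℕ.*-comm 3 (suc m))

StabilityAtMost : Graph → ℚ → Set
StabilityAtMost H α = ∀ S → Independent H S → sumℚ (indicator ∘ S) ≤ α

InStab⇒weight≤ : (H : Graph) {α : ℚ} → StabilityAtMost H α → ∀ {x} → InStab H x → sumℚ x ≤ α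
InStab⇒weight≤ H {α} bound {x} (k , λs , S , independent , λs≥0 , Σλs≡1 , x≡) = begin
  sumℚ x                                  ≡⟨ sumℚ≡sum x ⟩
  sum x                                   ≡⟨ sum-cong-≗ (λ w → trans (x≡ w) (sumℚ≡sum (summand w))) ⟩
  sum (λ w → sum (summand w))             ≡⟨ ∑-comm summand ⟩
  sum (λ j → sum (λ w → summand w j))     ≡⟨ sum-cong-≗ (≡.sym ∘ pull-out) ⟩
  sum (λ j → λs j * sumℚ (indicator ∘ S j)) ≤⟨ sum-mono-≤ weighted-bound ⟩
  sum (λ j → λs j * α)                    ≡⟨ ≡.sym (*-distribʳ-sum α λs) ⟩
  sum λs * α                              ≡⟨ cong (_* α) (trans (≡.sym (sumℚ≡sum λs)) Σλs≡1) ⟩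
  1ℚ * α                                  ≡⟨ *-identityˡ α ⟩
  α                                       ∎
  where
  open ≤-Reasoning
  summand : Fin (n H) → Fin k → ℚ
  summand w j = λs j * indicator (S j w)
  pull-out : ∀ j → λs j * sumℚ (indicator ∘ S j) ≡ sum (λ w → summand w j)
  pull-out j = trans (cong (λs j *_) (sumℚ≡sum (indicator ∘ S j)))
                     (*-distribˡ-sum (λs j) (indicator ∘ S j))
  weighted-bound : ∀ j → λs j * sumℚ (indicator ∘ S j) ≤ λs j * α
  weighted-bound j = *-monoˡ-≤-nonNeg (λs j) {{nonNegative (λs≥0 j)}} (bound (S j) (independent j))

small-stability⇒¬TPerfect : (H : Graph) {α : ℚ} → StabilityAtMost H α → α < n H · ⅓ →
                            ¬ TPerfect H
small-stability⇒¬TPerfect H {α} bound α<|H|/3 tPerfect = <-irrefl refl (<-≤-trans α<|H|/3 (begin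
  n H · ⅓               ≡⟨ ≡.sym (sumℚ-const (n H) ⅓) ⟩
  sumℚ {n H} (λ _ → ⅓)  ≤⟨ InStab⇒weight≤ H bound (Equivalence.to (tPerfect _) (⅓-InP H)) ⟩
  α                     ∎))
  where open ≤-Reasoning

Adj-sym : (G : Graph) {a b : Fin (n G)} → Adj G a b → Adj G b a
Adj-sym G {a} {b} = trans (Graph.sym G b a)

independent⇒¬Adj : (H : Graph) {S : Fin (n H) → Bool} → Independent H S →
                   ∀ {a b} → S a ≡ true → S b ≡ true → ¬ Adj H a b
independent⇒¬Adj H independent {a} {b} Sa Sb a~b with () ← trans (≡.sym (independent a b Sa Sb)) a~b

induced : (G : Graph) {k : ℕ} → (Fin k → Fin (n G)) → Graph
induced G {k} g = record
  { n   = k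
  ; adj = λ a b → adj G (g a) (g b)
  ; sym = λ a b → Graph.sym G (g a) (g b)
  ; irr = irr G ∘ g
  }

EnumeratesAllBut : {I X : Set} → X → (I → X) → Set
EnumeratesAllBut x τ =
  (∀ a b → τ a ≡ τ b → a ≡ b) × (∀ a → τ a ≢ x) × (∀ y → y ≢ x → ∃[ a ] τ a ≡ y)

∘-enumeratesAllBut : {I X Y : Set} {f : X → Y} →
                     (∀ x x' → f x ≡ f x' → x ≡ x') → (∀ y → ∃[ x ] f x ≡ y) →
                     ∀ {x} {τ : I → X} → EnumeratesAllBut x τ → EnumeratesAllBut (f x) (f ∘ τ)
∘-enumeratesAllBut {f = f} f-injective f-surjective {x} {τ} (τ-injective , τ≢x , τ-covers) =
  (λ a b → τ-injective a b ∘ f-injective _ _) , (λ a → τ≢x a ∘ f-injective _ _) , covers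
  where
  covers : ∀ y → y ≢ f x → ∃[ a ] f (τ a) ≡ y
  covers y y≢fx with f-surjective y
  ... | x' , refl with τ-covers x' (λ x'≡x → y≢fx (cong f x'≡x))
  ... | a , refl = a , refl

punchIn-enumeratesAllBut : ∀ {k} (d : Fin (suc k)) → EnumeratesAllBut d (punchIn d)
punchIn-enumeratesAllBut d =
  punchIn-injective d , punchInᵢ≢i d , λ y y≢d → punchOut (y≢d ∘ ≡.sym) , punchIn-punchOut _

enumeratesAllBut⇒DeleteStep : (G : Graph) {k : ℕ} {w : Fin (n G)} {g : Fin k → Fin (n G)} →
                              EnumeratesAllBut w g → DeleteStep G (induced G g)
enumeratesAllBut⇒DeleteStep G {w = w} {g} (injective , avoids , covers) =
  w , g , injective , avoids , covers , λ _ _ → refl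

StablePartition CliquePartition : (G : Graph) → Fin (n G) → Set
StablePartition G w = ∃[ σ ] Partition33 G w σ × (∀ k j j' → adj G (σ k j) (σ k j') ≡ false)
CliquePartition G w = ∃[ σ ] Partition33 G w σ × (∀ k j j' → j ≢ j' → Adj G (σ k j) (σ k j'))

enumeratesAllBut⇒Partition33 : (G : Graph) {w : Fin (n G)} {σ : Fin 3 × Fin 3 → Fin (n G)} →
                               EnumeratesAllBut w σ → Partition33 G w (curry σ)
enumeratesAllBut⇒Partition33 G (injective , avoids , covers) =
  (λ k j k' j' e → ×-≡,≡←≡ (injective _ _ e)) , curry avoids ,
  λ y y≢w → let ((k , j) , e) = covers y y≢w in k , j , e

module _ {I X : Set} (_≟ᴵ_ : DecidableEquality I) (_≟ˣ_ : DecidableEquality X)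
         (all-I? : ∀ {P : I → Set} → Decidable P → Dec (∀ a → P a))
         (any-I? : ∀ {P : I → Set} → Decidable P → Dec (∃ P))
         (all-X? : ∀ {P : X → Set} → Decidable P → Dec (∀ x → P x)) where

  enumeratesAllBut? : ∀ x (τ : I → X) → Dec (EnumeratesAllBut x τ)
  enumeratesAllBut? x τ =
    all-I? (λ a → all-I? λ b → (τ a ≟ˣ τ b) →-dec (a ≟ᴵ b)) ×-dec
    all-I? (λ a → ¬? (τ a ≟ˣ x)) ×-dec
    all-X? (λ y → ¬? (y ≟ˣ x) →-dec any-I? λ a → τ a ≟ˣ y)

all²? : ∀ {k m} {P : Fin k × Fin m → Set} → Decidable P → Dec (∀ a → P a)
all²? P? = map′ uncurry curry (all? λ k → all? λ j → P? (k , j))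

any²? : ∀ {k m} {P : Fin k × Fin m → Set} → Decidable P → Dec (∃ P)
any²? P? = map′ (λ (k , j , p) → (k , j) , p) (λ ((k , j) , p) → k , j , p)
                (any? λ k → any? λ j → P? (k , j))

Label : Set
Label = Fin 5 ⊎ Fin 5

pattern V i = inj₁ i
pattern U i = inj₂ i

_≟ᴸ_ : DecidableEquality Label
_≟ᴸ_ = ⊎-≡-dec _≟_ _≟_

allLabels? : ∀ {P : Label → Set} → Decidable P → Dec (∀ l → P l)
allLabels? P? = map′ (λ (onV , onU) → [ onV , onU ]) (λ all → all ∘ V , all ∘ U)
                     (all? (P? ∘ V) ×-dec all? (P? ∘ U))

rotate : Fin 5 → Label → Label
rotate i = map⊎ (_⊕ toℕ i) (_⊕ toℕ i)

consec? : ∀ i j → Dec (Consec 4 i j)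
consec? i j = (toℕ j ℕ.≟ suc (toℕ i) % 5) ⊎-dec (toℕ i ℕ.≟ suc (toℕ j) % 5)

-- The adjacencies forced by the hypotheses, and the non-adjacencies forced once no u_i u_{i+2}
-- is an edge; u_i v_i is in neither.
Edge NonEdge : Label → Label → Set
Edge (V i) (V j) = Consec 4 i j
Edge (U i) (V j) = j ≡ i ⊕ 2 ⊎ j ≡ i ⊕ 3
Edge (V j) (U i) = j ≡ i ⊕ 2 ⊎ j ≡ i ⊕ 3
Edge (U i) (U j) = j ≡ i ⊕ 1 ⊎ i ≡ j ⊕ 1
NonEdge (V i) (V j) = ¬ Consec 4 i j
NonEdge (U i) (V j) = j ≡ i ⊕ 1 ⊎ j ≡ i ⊕ 4
NonEdge (V j) (U i) = j ≡ i ⊕ 1 ⊎ j ≡ i ⊕ 4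
NonEdge (U i) (U j) = i ≡ j ⊎ j ≡ i ⊕ 2 ⊎ i ≡ j ⊕ 2

edge? : ∀ l l' → Dec (Edge l l')
edge? (V i) (V j) = consec? i j
edge? (U i) (V j) = (j ≟ i ⊕ 2) ⊎-dec (j ≟ i ⊕ 3)
edge? (V j) (U i) = (j ≟ i ⊕ 2) ⊎-dec (j ≟ i ⊕ 3)
edge? (U i) (U j) = (j ≟ i ⊕ 1) ⊎-dec (i ≟ j ⊕ 1)

nonEdge? : ∀ l l' → Dec (NonEdge l l')
nonEdge? (V i) (V j) = ¬? (consec? i j)
nonEdge? (U i) (V j) = (j ≟ i ⊕ 1) ⊎-dec (j ≟ i ⊕ 4)
nonEdge? (V j) (U i) = (j ≟ i ⊕ 1) ⊎-dec (j ≟ i ⊕ 4)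
nonEdge? (U i) (U j) = (i ≟ j) ⊎-dec (j ≟ i ⊕ 2) ⊎-dec (i ≟ j ⊕ 2)

Parts : Set
Parts = Fin 3 × Fin 3 → Label

fromRows : Vec (Vec Label 3) 3 → Parts
fromRows rows (k , j) = lookup (lookup rows k) j

-- The partitions at v_i and u_i are those at v_0 and u_0 rotated by i.
stableParts cliqueParts : Label → Parts
stableParts (V i) = rotate i ∘ fromRows
  ( (V 1F ∷ V 4F ∷ U 0F ∷ [])
  ∷ (V 2F ∷ U 1F ∷ U 3F ∷ [])
  ∷ (V 3F ∷ U 2F ∷ U 4F ∷ [])
  ∷ [])
stableParts (U i) = rotate i ∘ fromRows
  ( (V 0F ∷ U 1F ∷ U 4F ∷ [])
  ∷ (V 1F ∷ V 3F ∷ U 2F ∷ [])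
  ∷ (V 2F ∷ V 4F ∷ U 3F ∷ [])
  ∷ [])
cliqueParts (V i) = rotate i ∘ fromRows
  ( (V 1F ∷ U 3F ∷ U 4F ∷ [])
  ∷ (V 2F ∷ V 3F ∷ U 0F ∷ [])
  ∷ (V 4F ∷ U 1F ∷ U 2F ∷ [])
  ∷ [])
cliqueParts (U i) = rotate i ∘ fromRows
  ( (V 0F ∷ U 2F ∷ U 3F ∷ [])
  ∷ (V 1F ∷ V 2F ∷ U 4F ∷ [])
  ∷ (V 3F ∷ V 4F ∷ U 1F ∷ [])
  ∷ [])

partsEnumerateAllBut? : ∀ l (τ : Parts) → Dec (EnumeratesAllBut l τ)
partsEnumerateAllBut? = enumeratesAllBut? (×-≡-dec _≟_ _≟_) _≟ᴸ_ all²? any²? allLabels?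

stableParts-correct : ∀ l → EnumeratesAllBut l (stableParts l) ×
                            (∀ k j j' → NonEdge (stableParts l (k , j)) (stableParts l (k , j')))
stableParts-correct = from-yes (allLabels? λ l →
  partsEnumerateAllBut? l (stableParts l) ×-dec
  all? λ k → all? λ j → all? λ j' →
    nonEdge? (stableParts l (k , j)) (stableParts l (k , j')))

cliqueParts-correct : ∀ l → EnumeratesAllBut l (cliqueParts l) ×
                            (∀ k j j' → j ≢ j' → Edge (cliqueParts l (k , j)) (cliqueParts l (k , j')))
cliqueParts-correct = from-yes (allLabels? λ l →
  partsEnumerateAllBut? l (cliqueParts l) ×-dec
  all? λ k → all? λ j → all? λ j' →
    ¬? (j ≟ j') →-dec edge? (cliqueParts l (k , j)) (cliqueParts l (k , j')))

chordMinorLabels : Fin 5 → Fin 9 → Label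
chordMinorLabels i = lookup
  (V i ∷ V (i ⊕ 1) ∷ V (i ⊕ 2) ∷ U i ∷ U (i ⊕ 2) ∷ U (i ⊕ 3) ∷ U (i ⊕ 4) ∷ V (i ⊕ 4) ∷ U (i ⊕ 1) ∷ [])

chordMinorLabels-enumerateAllBut : ∀ i → EnumeratesAllBut (V (i ⊕ 3)) (chordMinorLabels i)
chordMinorLabels-enumerateAllBut = from-yes (all? λ i →
  enumeratesAllBut? _≟_ _≟ᴸ_ all? any? allLabels? (V (i ⊕ 3)) (chordMinorLabels i))

dropLastTwo : Fin 7 → Fin 9
dropLastTwo = punchIn 8F ∘ punchIn 7F

-- Vertices 0–6 stand for v_i, v_{i+1}, v_{i+2}, u_i, u_{i+2}, u_{i+3}, u_{i+4}; the edges are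
-- those forced by the hypotheses and the chord 3–4.  The complement is triangle-free.
chordMinorEdge : Fin 7 → Fin 7 → Bool
chordMinorEdge 0F 1F = true
chordMinorEdge 0F 4F = true
chordMinorEdge 0F 5F = true
chordMinorEdge 1F 2F = true
chordMinorEdge 1F 5F = true
chordMinorEdge 1F 6F = true
chordMinorEdge 2F 3F = true
chordMinorEdge 2F 6F = true
chordMinorEdge 3F 4F = true
chordMinorEdge 3F 6F = true
chordMinorEdge 4F 5F = true
chordMinorEdge 5F 6F = true
chordMinorEdge _  _  = false

chordMinorEdge-forced : ∀ i a b → T (chordMinorEdge a b) →
  (a ≡ 3F × b ≡ 4F) ⊎ Edge (chordMinorLabels i (dropLastTwo a)) (chordMinorLabels i (dropLastTwo b))
chordMinorEdge-forced = from-yes (all? λ i → all? λ a → all? λ b → T? (chordMinorEdge a b) →-dec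
  (((a ≟ 3F) ×-dec (b ≟ 4F)) ⊎-dec
   edge? (chordMinorLabels i (dropLastTwo a)) (chordMinorLabels i (dropLastTwo b))))

StableIn : ∀ {k} → (Fin k → Fin k → Bool) → (Fin k → Bool) → Set
StableIn E S = ∀ a b → T (E a b) → S a ≡ true → S b ≡ true → ⊥

stableIn? : ∀ {k} (E : Fin k → Fin k → Bool) S → Dec (StableIn E S)
stableIn? E S = all? λ a → all? λ b →
  T? (E a b) →-dec (S a ≟ᵇ true) →-dec (S b ≟ᵇ true) →-dec no λ ()

stableIn-≗ : ∀ {k} {E : Fin k → Fin k → Bool} {S S'} → S ≗ S' → StableIn E S → StableIn E S'
stableIn-≗ S≗S' stable a b e S'a S'b = stable a b e (trans (S≗S' a) S'a) (trans (S≗S' b) S'b)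

chordMinorEdge-stability≤2 : ∀ S → StableIn chordMinorEdge S → sumℚ (indicator ∘ S) ≤ 2ℚ
chordMinorEdge-stability≤2 S stable = ≮⇒≥ λ 2<|S| →
  noLargeStableSet (tabulate S , stableIn-≗ (≡.sym ∘ lookup∘tabulate S) stable ,
                    subst (2ℚ <_) (sumℚ-cong (cong indicator ∘ ≡.sym ∘ lookup∘tabulate S)) 2<|S|)
  where
  noLargeStableSet : ¬ ∃ λ (p : Subset 7) →
                       StableIn chordMinorEdge (lookup p) × 2ℚ < sumℚ (indicator ∘ lookup p)
  noLargeStableSet = from-no (anySubset? λ p →
    stableIn? chordMinorEdge (lookup p) ×-dec 2ℚ <? sumℚ (indicator ∘ lookup p))

module Configuration
  (G : Graph) (v u : Fin 5 → Fin (n G)) (hole : InducedCycle G v)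
  (v≢u : ∀ i j → v i ≢ u j) (u-injective : ∀ i j → u i ≡ u j → i ≡ j)
  (covers : ∀ w → (∃[ i ] v i ≡ w) ⊎ (∃[ i ] u i ≡ w))
  (attached : ∀ i → Adj G (u i) (v (i ⊕ 2)) × Adj G (u i) (v (i ⊕ 3)) ×
                    ¬ Adj G (u i) (v (i ⊕ 1)) × ¬ Adj G (u i) (v (i ⊕ 4)))
  (path : ∀ i → Adj G (u i) (u (i ⊕ 1)))
  where

  vertex : Label → Fin (n G)
  vertex = [ v , u ]′

  vertex-injective : ∀ l l' → vertex l ≡ vertex l' → l ≡ l'
  vertex-injective (V i) (V j) e = cong V (proj₁ hole i j e)
  vertex-injective (V i) (U j) e = ⊥-elim (v≢u i j e)
  vertex-injective (U i) (V j) e = ⊥-elim (v≢u j i (≡.sym e))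
  vertex-injective (U i) (U j) e = cong U (u-injective i j e)

  vertex-surjective : ∀ w → ∃[ l ] vertex l ≡ w
  vertex-surjective w = [ (λ (i , e) → V i , e) , (λ (i , e) → U i , e) ]′ (covers w)

  vertex-enumeratesAllBut : ∀ {I : Set} {l} {τ : I → Label} →
                            EnumeratesAllBut l τ → EnumeratesAllBut (vertex l) (vertex ∘ τ)
  vertex-enumeratesAllBut = ∘-enumeratesAllBut vertex-injective vertex-surjective

  u~v : ∀ i j → j ≡ i ⊕ 2 ⊎ j ≡ i ⊕ 3 → Adj G (u i) (v j)
  u~v i _ (inj₁ refl) = proj₁ (attached i)
  u~v i _ (inj₂ refl) = proj₁ (proj₂ (attached i))

  u≁v : ∀ i j → j ≡ i ⊕ 1 ⊎ j ≡ i ⊕ 4 → ¬ Adj G (u i) (v j)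
  u≁v i _ (inj₁ refl) = proj₁ (proj₂ (proj₂ (attached i)))
  u≁v i _ (inj₂ refl) = proj₂ (proj₂ (proj₂ (attached i)))

  edge-sound : ∀ l l' → Edge l l' → Adj G (vertex l) (vertex l')
  edge-sound (V i) (V j) consec      = Equivalence.from (proj₂ hole i j) consec
  edge-sound (U i) (V j) e           = u~v i j e
  edge-sound (V j) (U i) e           = Adj-sym G (u~v i j e)
  edge-sound (U i) (U _) (inj₁ refl) = path i
  edge-sound (U _) (U j) (inj₂ refl) = Adj-sym G (path j)

  NoChord : Set
  NoChord = ∀ i → ¬ Adj G (u i) (u (i ⊕ 2))

  nonEdge-sound : NoChord → ∀ l l' → NonEdge l l' → adj G (vertex l) (vertex l') ≡ false
  nonEdge-sound _       (V i) (V j) ¬consec            = ¬-not (¬consec ∘ Equivalence.to (proj₂ hole i j))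
  nonEdge-sound _       (U i) (V j) e                  = ¬-not (u≁v i j e)
  nonEdge-sound _       (V j) (U i) e                  = ¬-not (u≁v i j e ∘ Adj-sym G)
  nonEdge-sound _       (U i) (U _) (inj₁ refl)        = irr G (u i)
  nonEdge-sound noChord (U i) (U _) (inj₂ (inj₁ refl)) = ¬-not (noChord i)
  nonEdge-sound noChord (U _) (U j) (inj₂ (inj₂ refl)) = ¬-not (noChord j ∘ Adj-sym G)

  module ChordMinor (i : Fin 5) where

    G₉ G₈ G₇ : Graph
    G₉ = induced G (vertex ∘ chordMinorLabels i)
    G₈ = induced G₉ (punchIn 8F)
    G₇ = induced G₈ (punchIn 7F)

    isTMinor : TMinor G G₇
    isTMinor = deleteV₃ ◅◅ deleteV₄ ◅◅ deleteU₁
      where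
      deleteV₃ : TMinor G G₉
      deleteV₃ = inj₁ (enumeratesAllBut⇒DeleteStep G
                   (vertex-enumeratesAllBut (chordMinorLabels-enumerateAllBut i))) ◅ ε
      deleteV₄ : TMinor G₉ G₈
      deleteV₄ = inj₁ (enumeratesAllBut⇒DeleteStep G₉ (punchIn-enumeratesAllBut 8F)) ◅ ε
      deleteU₁ : TMinor G₈ G₇
      deleteU₁ = inj₁ (enumeratesAllBut⇒DeleteStep G₈ (punchIn-enumeratesAllBut 7F)) ◅ ε

    stability≤2 : Adj G (u i) (u (i ⊕ 2)) → StabilityAtMost G₇ 2ℚ
    stability≤2 chord S independent = chordMinorEdge-stability≤2 S λ a b e Sa Sb →
      independent⇒¬Adj G₇ independent Sa Sb (adjacent a b e)
      where
      adjacent : ∀ a b → T (chordMinorEdge a b) → Adj G₇ a b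
      adjacent a b e with chordMinorEdge-forced i a b e
      ... | inj₁ (refl , refl) = chord
      ... | inj₂ known         = edge-sound _ _ known

  no-chord : n G ≡ 10 → MinimallyTImperfect G → NoChord
  no-chord n≡10 (_ , properMinorsPerfect) i chord =
    small-stability⇒¬TPerfect G₇ (stability≤2 chord) (from-yes (2ℚ <? 7 · ⅓))
      (properMinorsPerfect G₇ isTMinor (subst (7 ℕ.<_) (≡.sym n≡10) (from-yes (7 ℕ.<? 10))))
    where open ChordMinor i

  partitionable : n G ≡ 10 → NoChord → Partitionable33 G
  partitionable n≡10 noChord = n≡10 , partitions
    where
    stablePartition : ∀ l → StablePartition G (vertex l)
    stablePartition l =
      curry (vertex ∘ stableParts l) ,
      enumeratesAllBut⇒Partition33 G (vertex-enumeratesAllBut (proj₁ (stableParts-correct l))) ,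
      λ k j j' → nonEdge-sound noChord _ _ (proj₂ (stableParts-correct l) k j j')
    cliquePartition : ∀ l → CliquePartition G (vertex l)
    cliquePartition l =
      curry (vertex ∘ cliqueParts l) ,
      enumeratesAllBut⇒Partition33 G (vertex-enumeratesAllBut (proj₁ (cliqueParts-correct l))) ,
      λ k j j' j≢j' → edge-sound _ _ (proj₂ (cliqueParts-correct l) k j j' j≢j')
    partitions : ∀ w → StablePartition G w × CliquePartition G w
    partitions w with vertex-surjective w
    ... | l , refl = stablePartition l , cliquePartition l

proposition17 : (G : Graph) → n G ≡ 10 →
    MinimallyTImperfect G → MinimallyTImperfect (complement G) →
    (v u : Fin 5 → Fin (n G)) →
    InducedCycle G v →
    (∀ i j → v i ≢ u j) → (∀ i j → u i ≡ u j → i ≡ j) →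
    (∀ w → (∃[ i ] v i ≡ w) ⊎ (∃[ i ] u i ≡ w)) →
    (∀ i → Adj G (u i) (v (i ⊕ 2)) × Adj G (u i) (v (i ⊕ 3)) ×
           ¬ Adj G (u i) (v (i ⊕ 1)) × ¬ Adj G (u i) (v (i ⊕ 4))) →
    (∀ i → Adj G (u i) (u (i ⊕ 1))) →
    Partitionable33 G
proposition17 G n≡10 minimal _ v u hole v≢u u-injective covers attached path =
  partitionable n≡10 (no-chord n≡10 minimal)
  where open Configuration G v u hole v≢u u-injective covers attached path
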